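{- $\mathrm{GSym}=\mathrm{LWQSym}$.
   Context: $X=\{x_1,x_2,\dots\}$. Weak compositions are finite sequences of nonnegative integers; left weak ones have positive last entry. For weak compositions $\alpha,\beta$ of length $k$ with $\alpha_k>0$, $\widehat{M}_{\binom{\alpha}{\beta}}=\sum_{0<i_1<\dots<i_k}i_1^{\beta_1}\cdots i_k^{\beta_k}x_{i_1}^{\alpha_1}\cdots x_{i_k}^{\alpha_k}$ ($i^0=1$); $\mathrm{GSym}$ is the $\mathbb{Q}$-span of all these in $\mathbb{Q}[[X]]$. For a left weak composition $\alpha$, $M_\alpha=\sum_{0<i_1<\dots<i_k}x_{i_1}^{\alpha_1}\cdots x_{i_k}^{\alpha_k}$ (with $M_\emptyset=1$ for the empty composition); $\mathrm{LWQSym}$ is the span of all these. -}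

module Defs where

open import Data.Nat as ℕ using (ℕ; zero; suc; _<_)
open import Data.Integer using (+_)
open import Data.Rational using (ℚ; 0ℚ; 1ℚ; _+_; _*_; _/_)
open import Data.List using (List; []; _∷_; map)
open import Data.Product using (_×_; _,_; proj₁; Σ)
open import Data.Unit using (⊤)
open import Data.Bool using (Bool; true; false; if_then_else_)
open import Relation.Nullary.Decidable using (⌊_⌋)
open import Relation.Binary.PropositionalEquality using (_≡_)

-- A monomial in X = {x₁, x₂, …}: the list m = (e₁, e₂, …, eₙ) stands for
-- x₁^e₁ ⋯ xₙ^eₙ (all later exponents are 0; trailing zeros are harmless).
Monomial : Set
Monomial = List ℕ

Series : Set
Series = Monomial → ℚ

_≈ₛ_ : Series → Series → Set
F ≈ₛ G = ∀ m → F m ≡ G m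

allZero : List ℕ → Bool
allZero [] = true
allZero (zero ∷ m) = allZero m
allZero (suc _ ∷ m) = false

ℕtoℚ : ℕ → ℚ
ℕtoℚ n = + n / 1

-- A pair of weak compositions (α, β) of equal length k is stored as the list
-- of columns ((α₁,β₁), …, (α_k,β_k)).
-- Condition "α_k > 0" (vacuous for k = 0).
LastPos : List (ℕ × ℕ) → Set
LastPos [] = ⊤
LastPos (c ∷ []) = 0 < proj₁ c
LastPos (_ ∷ d ∷ r) = LastPos (d ∷ r)

-- coeffHat cols m p : coefficient of the monomial x_p^{m₀} x_{p+1}^{m₁} ⋯
-- in  Σ_{p ≤ i₁ < ⋯ < i_k} i₁^{β₁}⋯i_k^{β_k} x_{i₁}^{α₁}⋯x_{i_k}^{α_k}
-- (valid whenever α_k > 0, which makes the sum finite per monomial).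
coeffHat : List (ℕ × ℕ) → Monomial → ℕ → ℚ
coeffHat [] m p = if allZero m then 1ℚ else 0ℚ
coeffHat (_ ∷ _) [] p = 0ℚ
coeffHat ((a , b) ∷ cs) (e ∷ m) p =
  (if ⌊ e ℕ.≟ a ⌋ then ℕtoℚ (p ℕ.^ b) * coeffHat cs m (suc p) else 0ℚ)
  + (if ⌊ e ℕ.≟ 0 ⌋ then coeffHat ((a , b) ∷ cs) m (suc p) else 0ℚ)

Mhat : List (ℕ × ℕ) → Series
Mhat cs m = coeffHat cs m 1

LastPosℕ : List ℕ → Set
LastPosℕ [] = ⊤
LastPosℕ (a ∷ []) = 0 < a
LastPosℕ (_ ∷ b ∷ r) = LastPosℕ (b ∷ r)

M : List ℕ → Series
M α = Mhat (map (λ a → a , 0) α)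

lincomb : {I : Set} → (I → Series) → List (ℚ × I) → Series
lincomb f [] m = 0ℚ
lincomb f ((q , i) ∷ r) m = q * f i m + lincomb f r m

ValidGSymIndex : Set
ValidGSymIndex = Σ (List (ℕ × ℕ)) LastPos

LeftWeakComp : Set
LeftWeakComp = Σ (List ℕ) LastPosℕ

InGSym : Series → Set
InGSym F = Σ (List (ℚ × ValidGSymIndex)) λ L → F ≈ₛ lincomb (λ c → Mhat (proj₁ c)) L

InLWQSym : Series → Set
InLWQSym F = Σ (List (ℚ × LeftWeakComp)) λ L → F ≈ₛ lincomb (λ c → M (proj₁ c)) L

-- The weight i^β of a column is a polynomial in its position i. Since
-- (i ∸ p) C j counts the ways to place j columns of zeros at positions p, …, i − 1,
-- expanding that polynomial in the basis (i ∸ p) C j, with p the position after the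
-- preceding column, turns the column into unweighted columns preceded by zeros, with
-- coefficients polynomial in p. Going from the last column to the first, these
-- coefficients are absorbed into the weight of the column to their left; at p = 1
-- they are constants, so every \widehat M is an ℕ-combination of M_α with α left
-- weak. Conversely M_α is \widehat M with β = 0.

module Submission where

open import Defs
open import Data.Bool using (Bool; true; false; if_then_else_)
open import Data.Integer as ℤ using (+_)
import Data.Integer.Properties as ℤₚ
import Data.Integer.Tactic.RingSolver as ℤ-Solver
open import Data.List using (List; []; _∷_; _++_; map; replicate; concatMap)
open import Data.List.Properties using (map-++; map-∘; ++-assoc)
open import Data.List.Relation.Unary.All as All using (All; []; _∷_)
open import Data.List.Relation.Unary.All.Properties using (concat⁺; map⁺)
open import Data.Nat as ℕ using (ℕ; zero; suc; _+_; _*_; _∸_; _^_; _≤_; _≟_)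
import Data.Nat.Coprimality as Coprime
open import Data.Nat.Combinatorics using (_C_; nC1≡n; nCk+nC[k+1]≡[n+1]C[k+1])
import Data.Nat.Properties as ℕₚ
open import Data.Nat.Tactic.RingSolver using (solve-∀)
open import Data.Product using (_×_; _,_; proj₁; proj₂; Σ)
open import Data.Rational as ℚ using (ℚ; 0ℚ; 1ℚ; toℚᵘ)
open import Data.Rational.Properties as ℚₚ using (normalize-coprime; toℚᵘ-injective; toℚᵘ-homo-+; toℚᵘ-homo-*)
import Data.Rational.Unnormalised as ℚᵘ
open import Data.Rational.Unnormalised using (mkℚᵘ; *≡*)
import Data.Rational.Unnormalised.Properties as ℚᵘₚ
open import Data.Unit using (tt)
open import Function using (_∘_; const)
open import Relation.Nullary.Decidable using (⌊_⌋)
open import Relation.Binary.PropositionalEquality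
open import Algebra.Properties.CommutativeSemigroup ℕₚ.+-commutativeSemigroup using (interchange)

toℚᵘ-ℕtoℚ : ∀ n → toℚᵘ (ℕtoℚ n) ≡ mkℚᵘ (+ n) 0
toℚᵘ-ℕtoℚ n = cong toℚᵘ (normalize-coprime (Coprime.sym (Coprime.1-coprimeTo n)))

ℕtoℚ-+ : ∀ m n → ℕtoℚ (m + n) ≡ ℕtoℚ m ℚ.+ ℕtoℚ n
ℕtoℚ-+ m n = toℚᵘ-injective (begin
  toℚᵘ (ℕtoℚ (m + n))              ≡⟨ toℚᵘ-ℕtoℚ (m + n) ⟩
  mkℚᵘ (+ (m + n)) 0               ≈⟨ *≡* (trans (cong (ℤ._* (+ 1 ℤ.* + 1)) (ℤₚ.pos-+ m n)) (lemma (+ m) (+ n))) ⟩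
  mkℚᵘ (+ m) 0 ℚᵘ.+ mkℚᵘ (+ n) 0   ≡⟨ cong₂ ℚᵘ._+_ (toℚᵘ-ℕtoℚ m) (toℚᵘ-ℕtoℚ n) ⟨
  toℚᵘ (ℕtoℚ m) ℚᵘ.+ toℚᵘ (ℕtoℚ n) ≈⟨ toℚᵘ-homo-+ (ℕtoℚ m) (ℕtoℚ n) ⟨
  toℚᵘ (ℕtoℚ m ℚ.+ ℕtoℚ n)         ∎)
  where
  open ℚᵘₚ.≃-Reasoning
  lemma : ∀ x y → (x ℤ.+ y) ℤ.* (+ 1 ℤ.* + 1) ≡ (x ℤ.* + 1 ℤ.+ y ℤ.* + 1) ℤ.* + 1
  lemma = ℤ-Solver.solve-∀

ℕtoℚ-* : ∀ m n → ℕtoℚ (m * n) ≡ ℕtoℚ m ℚ.* ℕtoℚ n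
ℕtoℚ-* m n = toℚᵘ-injective (begin
  toℚᵘ (ℕtoℚ (m * n))              ≡⟨ toℚᵘ-ℕtoℚ (m * n) ⟩
  mkℚᵘ (+ (m * n)) 0               ≈⟨ *≡* (trans (cong (ℤ._* (+ 1 ℤ.* + 1)) (ℤₚ.pos-* m n)) (lemma (+ m) (+ n))) ⟩
  mkℚᵘ (+ m) 0 ℚᵘ.* mkℚᵘ (+ n) 0   ≡⟨ cong₂ ℚᵘ._*_ (toℚᵘ-ℕtoℚ m) (toℚᵘ-ℕtoℚ n) ⟨
  toℚᵘ (ℕtoℚ m) ℚᵘ.* toℚᵘ (ℕtoℚ n) ≈⟨ toℚᵘ-homo-* (ℕtoℚ m) (ℕtoℚ n) ⟨
  toℚᵘ (ℕtoℚ m ℚ.* ℕtoℚ n)         ∎)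
  where
  open ℚᵘₚ.≃-Reasoning
  lemma : ∀ x y → (x ℤ.* y) ℤ.* (+ 1 ℤ.* + 1) ≡ (x ℤ.* y) ℤ.* + 1
  lemma = ℤ-Solver.solve-∀

when : Bool → ℕ → ℕ
when b n = if b then n else 0

when-0 : ∀ b → when b 0 ≡ 0
when-0 true  = refl
when-0 false = refl

when-+ : ∀ b x y → when b (x + y) ≡ when b x + when b y
when-+ true  x y = refl
when-+ false x y = refl

when-* : ∀ b k x → when b (k * x) ≡ k * when b x
when-* true  k x = refl
when-* false k x = sym (ℕₚ.*-zeroʳ k)

when-interchange : ∀ b c x y u v →
  when b (x + y) + when c (u + v) ≡ (when b x + when c u) + (when b y + when c v)
when-interchange b c x y u v =
  trans (cong₂ _+_ (when-+ b x y) (when-+ c u v)) (interchange (when b x) (when b y) (when c u) (when c v))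

-- prepend a w T m p is the coefficient of x_p^{m₀} x_{p+1}^{m₁} ⋯ in
-- Σ_{i ≥ p} w i · x_i^a · T_{i+1}, where T q is the series whose coefficients
-- at x_q^{n₀} x_{q+1}^{n₁} ⋯ are T n q.
prepend : ℕ → (ℕ → ℕ) → (Monomial → ℕ → ℕ) → Monomial → ℕ → ℕ
prepend a w T []      p = 0
prepend a w T (e ∷ m) p =
  when ⌊ e ≟ a ⌋ (w p * T m (suc p)) + when ⌊ e ≟ 0 ⌋ (prepend a w T m (suc p))

WColumn : Set
WColumn = ℕ × (ℕ → ℕ)

-- coeffHat with the weight i ↦ i^β of each column replaced by an arbitrary w.
coeffW : List WColumn → Monomial → ℕ → ℕ
coeffW []             m p = if allZero m then 1 else 0
coeffW ((a , w) ∷ cs) m p = prepend a w (coeffW cs) m p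

module _ (a : ℕ) where

  prepend-cong : ∀ {f g T U} m p → (∀ i → p ≤ i → f i ≡ g i) → (∀ n q → T n q ≡ U n q) →
                 prepend a f T m p ≡ prepend a g U m p
  prepend-cong []      p f≗g T≗U = refl
  prepend-cong (e ∷ m) p f≗g T≗U =
    cong₂ (λ x y → when ⌊ e ≟ a ⌋ x + when ⌊ e ≟ 0 ⌋ y)
          (cong₂ _*_ (f≗g p ℕₚ.≤-refl) (T≗U m (suc p)))
          (prepend-cong m (suc p) (λ i p<i → f≗g i (ℕₚ.<⇒≤ p<i)) T≗U)

  prepend-+ʷ : ∀ (f g : ℕ → ℕ) T m p →
    prepend a (λ i → f i + g i) T m p ≡ prepend a f T m p + prepend a g T m p
  prepend-+ʷ f g T []      p = refl
  prepend-+ʷ f g T (e ∷ m) p =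
    trans (cong₂ (λ x y → when ⌊ e ≟ a ⌋ x + when ⌊ e ≟ 0 ⌋ y)
                 (ℕₚ.*-distribʳ-+ (T m (suc p)) (f p) (g p)) (prepend-+ʷ f g T m (suc p)))
          (when-interchange ⌊ e ≟ a ⌋ ⌊ e ≟ 0 ⌋ _ _ _ _)

  prepend-+ᵗ : ∀ (w : ℕ → ℕ) (T U : Monomial → ℕ → ℕ) m p →
    prepend a w (λ n q → T n q + U n q) m p ≡ prepend a w T m p + prepend a w U m p
  prepend-+ᵗ w T U []      p = refl
  prepend-+ᵗ w T U (e ∷ m) p =
    trans (cong₂ (λ x y → when ⌊ e ≟ a ⌋ x + when ⌊ e ≟ 0 ⌋ y)
                 (ℕₚ.*-distribˡ-+ (w p) (T m (suc p)) (U m (suc p))) (prepend-+ᵗ w T U m (suc p)))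
          (when-interchange ⌊ e ≟ a ⌋ ⌊ e ≟ 0 ⌋ _ _ _ _)

  prepend-*ʷ : ∀ k (f : ℕ → ℕ) T m p → prepend a (λ i → k * f i) T m p ≡ k * prepend a f T m p
  prepend-*ʷ k f T []      p = sym (ℕₚ.*-zeroʳ k)
  prepend-*ʷ k f T (e ∷ m) p = begin
    when ⌊ e ≟ a ⌋ (k * f p * T m (suc p)) + when ⌊ e ≟ 0 ⌋ (prepend a (λ i → k * f i) T m (suc p))
      ≡⟨ cong₂ (λ x y → when ⌊ e ≟ a ⌋ x + when ⌊ e ≟ 0 ⌋ y)
               (ℕₚ.*-assoc k (f p) (T m (suc p))) (prepend-*ʷ k f T m (suc p)) ⟩
    when ⌊ e ≟ a ⌋ (k * (f p * T m (suc p))) + when ⌊ e ≟ 0 ⌋ (k * prepend a f T m (suc p))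
      ≡⟨ cong₂ _+_ (when-* ⌊ e ≟ a ⌋ k _) (when-* ⌊ e ≟ 0 ⌋ k _) ⟩
    k * when ⌊ e ≟ a ⌋ (f p * T m (suc p)) + k * when ⌊ e ≟ 0 ⌋ (prepend a f T m (suc p))
      ≡⟨ ℕₚ.*-distribˡ-+ k _ _ ⟨
    k * prepend a f T (e ∷ m) p ∎
    where open ≡-Reasoning

  prepend-0ʷ : ∀ T m p → prepend a (const 0) T m p ≡ 0
  prepend-0ʷ T []      p = refl
  prepend-0ʷ T (e ∷ m) p = cong₂ _+_ (when-0 ⌊ e ≟ a ⌋)
    (trans (cong (when ⌊ e ≟ 0 ⌋) (prepend-0ʷ T m (suc p))) (when-0 ⌊ e ≟ 0 ⌋))

  prepend-0ᵗ : ∀ (w : ℕ → ℕ) m p → prepend a w (λ _ _ → 0) m p ≡ 0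
  prepend-0ᵗ w []      p = refl
  prepend-0ᵗ w (e ∷ m) p = cong₂ _+_
    (trans (cong (when ⌊ e ≟ a ⌋) (ℕₚ.*-zeroʳ (w p))) (when-0 ⌊ e ≟ a ⌋))
    (trans (cong (when ⌊ e ≟ 0 ⌋) (prepend-0ᵗ w m (suc p))) (when-0 ⌊ e ≟ 0 ⌋))

  prepend-absorb : ∀ (w c : ℕ → ℕ) T m p →
    prepend a w (λ n q → c q * T n q) m p ≡ prepend a (λ i → w i * c (suc i)) T m p
  prepend-absorb w c T []      p = refl
  prepend-absorb w c T (e ∷ m) p =
    cong₂ (λ x y → when ⌊ e ≟ a ⌋ x + when ⌊ e ≟ 0 ⌋ y)
          (sym (ℕₚ.*-assoc (w p) (c (suc p)) (T m (suc p)))) (prepend-absorb w c T m (suc p))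

unweighted : List ℕ → List WColumn
unweighted = map (λ a → a , const 1)

-- (i ∸ p) C j counts the positions p ≤ i₁ < ⋯ < i_j < i of j columns of zeros.
coeffW-zeros : ∀ a cs j m p →
  coeffW (unweighted (replicate j 0) ++ (a , const 1) ∷ cs) m p ≡ prepend a (λ i → (i ∸ p) C j) (coeffW cs) m p
coeffW-zeros a cs zero    m       p = refl
coeffW-zeros a cs (suc j) []      p = refl
coeffW-zeros a cs (suc j) (e ∷ m) p = begin
  when z (1 * coeffW (unweighted (replicate j 0) ++ (a , const 1) ∷ cs) m (suc p))
    + when z (coeffW (unweighted (replicate (suc j) 0) ++ (a , const 1) ∷ cs) m (suc p))
    ≡⟨ cong₂ (λ x y → when z x + when z y)
             (trans (ℕₚ.*-identityˡ _) (coeffW-zeros a cs j m (suc p))) (coeffW-zeros a cs (suc j) m (suc p)) ⟩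
  when z (prepend a (λ i → (i ∸ suc p) C j) (coeffW cs) m (suc p))
    + when z (prepend a (λ i → (i ∸ suc p) C suc j) (coeffW cs) m (suc p))
    ≡⟨ when-+ z _ _ ⟨
  when z (prepend a (λ i → (i ∸ suc p) C j) (coeffW cs) m (suc p)
           + prepend a (λ i → (i ∸ suc p) C suc j) (coeffW cs) m (suc p))
    ≡⟨ cong (when z) pascal ⟨
  when z (prepend a (λ i → (i ∸ p) C suc j) (coeffW cs) m (suc p))
    ≡⟨ cong (_+ when z (prepend a (λ i → (i ∸ p) C suc j) (coeffW cs) m (suc p))) vanishes-at-p ⟨
  prepend a (λ i → (i ∸ p) C suc j) (coeffW cs) (e ∷ m) p ∎
  where
  open ≡-Reasoning
  z = ⌊ e ≟ 0 ⌋
  pascal : prepend a (λ i → (i ∸ p) C suc j) (coeffW cs) m (suc p)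
         ≡ prepend a (λ i → (i ∸ suc p) C j) (coeffW cs) m (suc p)
           + prepend a (λ i → (i ∸ suc p) C suc j) (coeffW cs) m (suc p)
  pascal = trans
    (prepend-cong a m (suc p)
      (λ i p<i → trans (cong (_C suc j) (ℕₚ.+-∸-assoc 1 p<i)) (sym (nCk+nC[k+1]≡[n+1]C[k+1] (i ∸ suc p) j)))
      (λ _ _ → refl))
    (prepend-+ʷ a _ _ (coeffW cs) m (suc p))
  vanishes-at-p : when ⌊ e ≟ a ⌋ (((p ∸ p) C suc j) * coeffW cs m (suc p)) ≡ 0
  vanishes-at-p = trans (cong (λ t → when ⌊ e ≟ a ⌋ ((t C suc j) * coeffW cs m (suc p))) (ℕₚ.n∸n≡0 p))
                      (when-0 ⌊ e ≟ a ⌋)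

n*nCk≡k*nCk+[1+k]*nC[1+k] : ∀ n k → n * (n C k) ≡ k * (n C k) + suc k * (n C suc k)
n*nCk≡k*nCk+[1+k]*nC[1+k] zero    zero    = refl
n*nCk≡k*nCk+[1+k]*nC[1+k] zero    (suc k) = sym (cong₂ _+_ (ℕₚ.*-zeroʳ (suc k)) (ℕₚ.*-zeroʳ (suc (suc k))))
n*nCk≡k*nCk+[1+k]*nC[1+k] (suc n) zero    =
  trans (ℕₚ.*-identityʳ (suc n)) (sym (trans (ℕₚ.+-identityʳ _) (nC1≡n (suc n))))
n*nCk≡k*nCk+[1+k]*nC[1+k] (suc n) (suc k) = begin
  suc n * (suc n C suc k)                           ≡⟨ cong (suc n *_) (pascal k) ⟨
  suc n * (A + B)                                   ≡⟨ expand-left n A B ⟩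
  A + B + n * A + n * B                             ≡⟨ cong₂ (λ x y → A + B + x + y)
                                                             (n*nCk≡k*nCk+[1+k]*nC[1+k] n k)
                                                             (n*nCk≡k*nCk+[1+k]*nC[1+k] n (suc k)) ⟩
  A + B + (k * A + suc k * B) + (suc k * B + suc (suc k) * D)
                                                    ≡⟨ regroup k A B D ⟩
  suc k * (A + B) + suc (suc k) * (B + D)           ≡⟨ cong₂ (λ x y → suc k * x + suc (suc k) * y)
                                                             (pascal k) (pascal (suc k)) ⟩
  suc k * (suc n C suc k) + suc (suc k) * (suc n C suc (suc k)) ∎
  where
  open ≡-Reasoning
  A = n C k
  B = n C suc k
  D = n C suc (suc k)
  pascal : ∀ k → n C k + n C suc k ≡ suc n C suc k
  pascal = nCk+nC[k+1]≡[n+1]C[k+1] n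
  expand-left : ∀ n A B → suc n * (A + B) ≡ A + B + n * A + n * B
  expand-left = solve-∀
  regroup : ∀ k A B D → A + B + (k * A + suc k * B) + (suc k * B + suc (suc k) * D)
                      ≡ suc k * (A + B) + suc (suc k) * (B + D)
  regroup = solve-∀

infixl 6 _⊕_
infixl 7 _⊗_

data Poly : Set where
  con     : ℕ → Poly
  var     : Poly
  _⊕_ _⊗_ : Poly → Poly → Poly

⟦_⟧ : Poly → ℕ → ℕ
⟦ con c ⟧ x = c
⟦ var   ⟧ x = x
⟦ P ⊕ Q ⟧ x = ⟦ P ⟧ x + ⟦ Q ⟧ x
⟦ P ⊗ Q ⟧ x = ⟦ P ⟧ x * ⟦ Q ⟧ x

shift : Poly → Poly
shift (con c) = con c
shift var     = var ⊕ con 1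
shift (P ⊕ Q) = shift P ⊕ shift Q
shift (P ⊗ Q) = shift P ⊗ shift Q

⟦shift⟧ : ∀ P x → ⟦ shift P ⟧ x ≡ ⟦ P ⟧ (suc x)
⟦shift⟧ (con c) x = refl
⟦shift⟧ var     x = ℕₚ.+-comm x 1
⟦shift⟧ (P ⊕ Q) x = cong₂ _+_ (⟦shift⟧ P x) (⟦shift⟧ Q x)
⟦shift⟧ (P ⊗ Q) x = cong₂ _*_ (⟦shift⟧ P x) (⟦shift⟧ Q x)

_^ᴾ_ : Poly → ℕ → Poly
P ^ᴾ zero  = con 1
P ^ᴾ suc b = P ⊗ P ^ᴾ b

⟦var^ᴾ⟧ : ∀ b x → ⟦ var ^ᴾ b ⟧ x ≡ x ^ b
⟦var^ᴾ⟧ zero    x = refl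
⟦var^ᴾ⟧ (suc b) x = cong (x *_) (⟦var^ᴾ⟧ b x)

binomialSum : ℕ → List Poly → ℕ → ℕ → ℕ
binomialSum j []      s t = 0
binomialSum j (R ∷ E) s t = ⟦ R ⟧ s * (t C j) + binomialSum (suc j) E s t

scaleᴱ : ℕ → List Poly → List Poly
scaleᴱ c = map (con c ⊗_)

binomialSum-scaleᴱ : ∀ c j E s t → binomialSum j (scaleᴱ c E) s t ≡ c * binomialSum j E s t
binomialSum-scaleᴱ c j []      s t = sym (ℕₚ.*-zeroʳ c)
binomialSum-scaleᴱ c j (R ∷ E) s t =
  trans (cong (_+_ (c * ⟦ R ⟧ s * (t C j))) (binomialSum-scaleᴱ c (suc j) E s t))
        (lemma c (⟦ R ⟧ s) (t C j) (binomialSum (suc j) E s t))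
  where
  lemma : ∀ c R B S → c * R * B + c * S ≡ c * (R * B + S)
  lemma = solve-∀

_+ᴱ_ : List Poly → List Poly → List Poly
[]      +ᴱ F       = F
(R ∷ E) +ᴱ []      = R ∷ E
(R ∷ E) +ᴱ (R' ∷ F) = R ⊕ R' ∷ E +ᴱ F

binomialSum-+ᴱ : ∀ j E F s t → binomialSum j (E +ᴱ F) s t ≡ binomialSum j E s t + binomialSum j F s t
binomialSum-+ᴱ j []      F        s t = refl
binomialSum-+ᴱ j (R ∷ E) []       s t = sym (ℕₚ.+-identityʳ _)
binomialSum-+ᴱ j (R ∷ E) (R' ∷ F) s t =
  trans (cong (_+_ ((⟦ R ⟧ s + ⟦ R' ⟧ s) * (t C j))) (binomialSum-+ᴱ (suc j) E F s t))
        (lemma (⟦ R ⟧ s) (⟦ R' ⟧ s) (t C j) (binomialSum (suc j) E s t) (binomialSum (suc j) F s t))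
  where
  lemma : ∀ a b B x y → (a + b) * B + (x + y) ≡ (a * B + x) + (b * B + y)
  lemma = solve-∀

-- Multiplies by s + t, using t · C(t, j) = j · C(t, j) + (j + 1) · C(t, j + 1).
mulVarᴱ : ℕ → List Poly → List Poly
mulVarᴱ j []      = []
mulVarᴱ j (R ∷ E) = R ⊗ (var ⊕ con j) ∷ (con (suc j) ⊗ R ∷ []) +ᴱ mulVarᴱ (suc j) E

binomialSum-mulVarᴱ : ∀ j E s t → binomialSum j (mulVarᴱ j E) s t ≡ (s + t) * binomialSum j E s t
binomialSum-mulVarᴱ j []      s t = sym (ℕₚ.*-zeroʳ (s + t))
binomialSum-mulVarᴱ j (R ∷ E) s t = begin
  Rs * (s + j) * Cj + binomialSum (suc j) ((con (suc j) ⊗ R ∷ []) +ᴱ mulVarᴱ (suc j) E) s t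
    ≡⟨ cong (_+_ (Rs * (s + j) * Cj))
            (trans (binomialSum-+ᴱ (suc j) (con (suc j) ⊗ R ∷ []) (mulVarᴱ (suc j) E) s t)
                   (cong (_+_ (suc j * Rs * Cj′ + 0)) (binomialSum-mulVarᴱ (suc j) E s t))) ⟩
  Rs * (s + j) * Cj + (suc j * Rs * Cj′ + 0 + (s + t) * S)
    ≡⟨ regroup Rs s j Cj Cj′ t S ⟩
  s * Rs * Cj + Rs * (j * Cj + suc j * Cj′) + (s + t) * S
    ≡⟨ cong (λ x → s * Rs * Cj + Rs * x + (s + t) * S) (n*nCk≡k*nCk+[1+k]*nC[1+k] t j) ⟨
  s * Rs * Cj + Rs * (t * Cj) + (s + t) * S
    ≡⟨ collect Rs s t Cj S ⟩
  (s + t) * (Rs * Cj + S) ∎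
  where
  open ≡-Reasoning
  Rs  = ⟦ R ⟧ s
  Cj  = t C j
  Cj′ = t C suc j
  S   = binomialSum (suc j) E s t
  regroup : ∀ Rs s j Cj Cj′ t S → Rs * (s + j) * Cj + (suc j * Rs * Cj′ + 0 + (s + t) * S)
                                 ≡ s * Rs * Cj + Rs * (j * Cj + suc j * Cj′) + (s + t) * S
  regroup = solve-∀
  collect : ∀ Rs s t Cj S → s * Rs * Cj + Rs * (t * Cj) + (s + t) * S ≡ (s + t) * (Rs * Cj + S)
  collect = solve-∀

mulᴱ : Poly → List Poly → List Poly
mulᴱ (con c) E = scaleᴱ c E
mulᴱ var     E = mulVarᴱ 0 E
mulᴱ (P ⊕ Q) E = mulᴱ P E +ᴱ mulᴱ Q E
mulᴱ (P ⊗ Q) E = mulᴱ Q (mulᴱ P E)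

binomialSum-mulᴱ : ∀ P E s t → binomialSum 0 (mulᴱ P E) s t ≡ ⟦ P ⟧ (s + t) * binomialSum 0 E s t
binomialSum-mulᴱ (con c) E s t = binomialSum-scaleᴱ c 0 E s t
binomialSum-mulᴱ var     E s t = binomialSum-mulVarᴱ 0 E s t
binomialSum-mulᴱ (P ⊕ Q) E s t = begin
  binomialSum 0 (mulᴱ P E +ᴱ mulᴱ Q E) s t
    ≡⟨ binomialSum-+ᴱ 0 (mulᴱ P E) (mulᴱ Q E) s t ⟩
  binomialSum 0 (mulᴱ P E) s t + binomialSum 0 (mulᴱ Q E) s t
    ≡⟨ cong₂ _+_ (binomialSum-mulᴱ P E s t) (binomialSum-mulᴱ Q E s t) ⟩
  ⟦ P ⟧ (s + t) * binomialSum 0 E s t + ⟦ Q ⟧ (s + t) * binomialSum 0 E s t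
    ≡⟨ ℕₚ.*-distribʳ-+ (binomialSum 0 E s t) (⟦ P ⟧ (s + t)) (⟦ Q ⟧ (s + t)) ⟨
  ⟦ P ⊕ Q ⟧ (s + t) * binomialSum 0 E s t ∎
  where open ≡-Reasoning
binomialSum-mulᴱ (P ⊗ Q) E s t = begin
  binomialSum 0 (mulᴱ Q (mulᴱ P E)) s t
    ≡⟨ binomialSum-mulᴱ Q (mulᴱ P E) s t ⟩
  ⟦ Q ⟧ (s + t) * binomialSum 0 (mulᴱ P E) s t
    ≡⟨ cong (⟦ Q ⟧ (s + t) *_) (binomialSum-mulᴱ P E s t) ⟩
  ⟦ Q ⟧ (s + t) * (⟦ P ⟧ (s + t) * binomialSum 0 E s t)
    ≡⟨ ℕₚ.*-assoc (⟦ Q ⟧ (s + t)) _ _ ⟨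
  ⟦ Q ⟧ (s + t) * ⟦ P ⟧ (s + t) * binomialSum 0 E s t
    ≡⟨ cong (_* binomialSum 0 E s t) (ℕₚ.*-comm (⟦ Q ⟧ (s + t)) _) ⟩
  ⟦ P ⊗ Q ⟧ (s + t) * binomialSum 0 E s t ∎
  where open ≡-Reasoning

newton : Poly → List Poly
newton P = mulᴱ P (con 1 ∷ [])

binomialSum-newton : ∀ P s t → binomialSum 0 (newton P) s t ≡ ⟦ P ⟧ (s + t)
binomialSum-newton P s t = trans (binomialSum-mulᴱ P (con 1 ∷ []) s t) (ℕₚ.*-identityʳ _)

-- A term (c , α) stands for c(s) · M_α with M_α started at position s.
Combination : Set
Combination = List (Poly × List ℕ)

⟦_⟧ᶜ : Combination → Monomial → ℕ → ℕ
⟦ []          ⟧ᶜ m s = 0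
⟦ (c , α) ∷ L ⟧ᶜ m s = ⟦ c ⟧ s * coeffW (unweighted α) m s + ⟦ L ⟧ᶜ m s

⟦++⟧ᶜ : ∀ L L′ m s → ⟦ L ++ L′ ⟧ᶜ m s ≡ ⟦ L ⟧ᶜ m s + ⟦ L′ ⟧ᶜ m s
⟦++⟧ᶜ []            L′ m s = refl
⟦++⟧ᶜ ((c , α) ∷ L) L′ m s =
  trans (cong (_+_ (⟦ c ⟧ s * coeffW (unweighted α) m s)) (⟦++⟧ᶜ L L′ m s))
        (sym (ℕₚ.+-assoc (⟦ c ⟧ s * coeffW (unweighted α) m s) (⟦ L ⟧ᶜ m s) (⟦ L′ ⟧ᶜ m s)))

zerosThen : ℕ → List ℕ → ℕ → List Poly → Combination
zerosThen a α j []      = []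
zerosThen a α j (R ∷ E) = (R , replicate j 0 ++ a ∷ α) ∷ zerosThen a α (suc j) E

prepend-binomialSum : ∀ a α j E s m →
  prepend a (λ i → binomialSum j E s (i ∸ s)) (coeffW (unweighted α)) m s ≡ ⟦ zerosThen a α j E ⟧ᶜ m s
prepend-binomialSum a α j []      s m = prepend-0ʷ a (coeffW (unweighted α)) m s
prepend-binomialSum a α j (R ∷ E) s m = begin
  prepend a (λ i → ⟦ R ⟧ s * ((i ∸ s) C j) + binomialSum (suc j) E s (i ∸ s)) T m s
    ≡⟨ prepend-+ʷ a _ _ T m s ⟩
  prepend a (λ i → ⟦ R ⟧ s * ((i ∸ s) C j)) T m s + prepend a (λ i → binomialSum (suc j) E s (i ∸ s)) T m s
    ≡⟨ cong₂ _+_ (prepend-*ʷ a (⟦ R ⟧ s) _ T m s) (prepend-binomialSum a α (suc j) E s m) ⟩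
  ⟦ R ⟧ s * prepend a (λ i → (i ∸ s) C j) T m s + ⟦ zerosThen a α (suc j) E ⟧ᶜ m s
    ≡⟨ cong (λ x → ⟦ R ⟧ s * x + ⟦ zerosThen a α (suc j) E ⟧ᶜ m s) zeros ⟨
  ⟦ zerosThen a α j (R ∷ E) ⟧ᶜ m s ∎
  where
  open ≡-Reasoning
  T = coeffW (unweighted α)
  zeros : coeffW (unweighted (replicate j 0 ++ a ∷ α)) m s ≡ prepend a (λ i → (i ∸ s) C j) T m s
  zeros = trans (cong (λ cs → coeffW cs m s) (map-++ _ (replicate j 0) (a ∷ α)))
                (coeffW-zeros a (unweighted α) j m s)

coeffW-newton : ∀ a α P s m → coeffW ((a , ⟦ P ⟧) ∷ unweighted α) m s ≡ ⟦ zerosThen a α 0 (newton P) ⟧ᶜ m s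
coeffW-newton a α P s m = trans
  (prepend-cong a m s
    (λ i s≤i → trans (cong ⟦ P ⟧ (sym (ℕₚ.m+[n∸m]≡n s≤i))) (sym (binomialSum-newton P s (i ∸ s))))
    (λ _ _ → refl))
  (prepend-binomialSum a α 0 (newton P) s m)

-- A tail term c(s) · M_α contributes the column weight w(i) · c(i + 1).
prependColumn : ℕ → Poly → Combination → Combination
prependColumn a w = concatMap (λ (c , α) → zerosThen a α 0 (newton (w ⊗ shift c)))

prepend-⟦⟧ᶜ : ∀ a w L m s → prepend a ⟦ w ⟧ ⟦ L ⟧ᶜ m s ≡ ⟦ prependColumn a w L ⟧ᶜ m s
prepend-⟦⟧ᶜ a w []            m s = prepend-0ᵗ a ⟦ w ⟧ m s
prepend-⟦⟧ᶜ a w ((c , α) ∷ L) m s = begin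
  prepend a ⟦ w ⟧ (λ n q → ⟦ c ⟧ q * coeffW (unweighted α) n q + ⟦ L ⟧ᶜ n q) m s
    ≡⟨ prepend-+ᵗ a ⟦ w ⟧ (λ n q → ⟦ c ⟧ q * coeffW (unweighted α) n q) ⟦ L ⟧ᶜ m s ⟩
  prepend a ⟦ w ⟧ (λ n q → ⟦ c ⟧ q * coeffW (unweighted α) n q) m s + prepend a ⟦ w ⟧ ⟦ L ⟧ᶜ m s
    ≡⟨ cong₂ _+_ head (prepend-⟦⟧ᶜ a w L m s) ⟩
  ⟦ zerosThen a α 0 (newton (w ⊗ shift c)) ⟧ᶜ m s + ⟦ prependColumn a w L ⟧ᶜ m s
    ≡⟨ ⟦++⟧ᶜ (zerosThen a α 0 (newton (w ⊗ shift c))) (prependColumn a w L) m s ⟨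
  ⟦ prependColumn a w ((c , α) ∷ L) ⟧ᶜ m s ∎
  where
  open ≡-Reasoning
  head : prepend a ⟦ w ⟧ (λ n q → ⟦ c ⟧ q * coeffW (unweighted α) n q) m s
       ≡ ⟦ zerosThen a α 0 (newton (w ⊗ shift c)) ⟧ᶜ m s
  head = begin
    prepend a ⟦ w ⟧ (λ n q → ⟦ c ⟧ q * coeffW (unweighted α) n q) m s
      ≡⟨ prepend-absorb a ⟦ w ⟧ ⟦ c ⟧ (coeffW (unweighted α)) m s ⟩
    prepend a (λ i → ⟦ w ⟧ i * ⟦ c ⟧ (suc i)) (coeffW (unweighted α)) m s
      ≡⟨ prepend-cong a m s (λ i _ → cong (⟦ w ⟧ i *_) (⟦shift⟧ c i)) (λ _ _ → refl) ⟨
    coeffW ((a , ⟦ w ⊗ shift c ⟧) ∷ unweighted α) m s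
      ≡⟨ coeffW-newton a α (w ⊗ shift c) s m ⟩
    ⟦ zerosThen a α 0 (newton (w ⊗ shift c)) ⟧ᶜ m s ∎

weighted : List (ℕ × Poly) → List WColumn
weighted = map (λ (a , w) → a , ⟦ w ⟧)

expand : List (ℕ × Poly) → Combination
expand []             = (con 1 , []) ∷ []
expand ((a , w) ∷ cs) = prependColumn a w (expand cs)

coeffW≡⟦expand⟧ᶜ : ∀ cs m s → coeffW (weighted cs) m s ≡ ⟦ expand cs ⟧ᶜ m s
coeffW≡⟦expand⟧ᶜ []             m s = sym (trans (ℕₚ.+-identityʳ _) (ℕₚ.*-identityˡ _))
coeffW≡⟦expand⟧ᶜ ((a , w) ∷ cs) m s =
  trans (prepend-cong a m s (λ _ _ → refl) (coeffW≡⟦expand⟧ᶜ cs)) (prepend-⟦⟧ᶜ a w (expand cs) m s)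

LastPosℕ-++ : ∀ xs {a α} → LastPosℕ (a ∷ α) → LastPosℕ (xs ++ a ∷ α)
LastPosℕ-++ []           h = h
LastPosℕ-++ (x ∷ [])     h = h
LastPosℕ-++ (x ∷ y ∷ xs) h = LastPosℕ-++ (y ∷ xs) h

zerosThen-lastPos : ∀ xs a α j E → LastPosℕ (a ∷ α) →
                    All (λ x → LastPosℕ (xs ++ proj₂ x)) (zerosThen a α j E)
zerosThen-lastPos xs a α j []      h = []
zerosThen-lastPos xs a α j (R ∷ E) h =
  subst LastPosℕ (++-assoc xs (replicate j 0) (a ∷ α)) (LastPosℕ-++ (xs ++ replicate j 0) h)
  ∷ zerosThen-lastPos xs a α (suc j) E h

prependColumn-lastPos : ∀ xs a w L → All (λ x → LastPosℕ (a ∷ proj₂ x)) L →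
                        All (λ x → LastPosℕ (xs ++ proj₂ x)) (prependColumn a w L)
prependColumn-lastPos xs a w L h =
  concat⁺ (map⁺ (All.map (λ {x} → zerosThen-lastPos xs a (proj₂ x) 0 (newton (w ⊗ shift (proj₁ x)))) h))

powerColumns : List (ℕ × ℕ) → List (ℕ × Poly)
powerColumns = map (λ (a , b) → a , var ^ᴾ b)

expand-lastPos-∷ : ∀ a b cs → LastPos ((a , b) ∷ cs) →
                   All (λ x → LastPosℕ (a ∷ proj₂ x)) (expand (powerColumns cs))
expand-lastPos-∷ a b []               h = h ∷ []
expand-lastPos-∷ a b ((a′ , b′) ∷ cs) h =
  prependColumn-lastPos (a ∷ []) a′ (var ^ᴾ b′) _ (expand-lastPos-∷ a′ b′ cs h)

expand-lastPos : ∀ cs → LastPos cs → All (LastPosℕ ∘ proj₂) (expand (powerColumns cs))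
expand-lastPos []             h = tt ∷ []
expand-lastPos ((a , b) ∷ cs) h = prependColumn-lastPos [] a (var ^ᴾ b) _ (expand-lastPos-∷ a b cs h)

ℕtoℚ-when : ∀ b {q} n → q ≡ ℕtoℚ n → (if b then q else 0ℚ) ≡ ℕtoℚ (when b n)
ℕtoℚ-when true  n q≡n = q≡n
ℕtoℚ-when false n q≡n = refl

coeffHat≡coeffW : ∀ cs m p → coeffHat cs m p ≡ ℕtoℚ (coeffW (weighted (powerColumns cs)) m p)
coeffHat≡coeffW []             m       p = ℕtoℚ-when (allZero m) 1 refl
coeffHat≡coeffW (_ ∷ _)        []      p = refl
coeffHat≡coeffW ((a , b) ∷ cs) (e ∷ m) p = trans
  (cong₂ ℚ._+_
    (ℕtoℚ-when ⌊ e ≟ a ⌋ (W * G)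
      (trans (cong₂ ℚ._*_ (cong ℕtoℚ (sym (⟦var^ᴾ⟧ b p))) (coeffHat≡coeffW cs m (suc p))) (sym (ℕtoℚ-* W G))))
    (ℕtoℚ-when ⌊ e ≟ 0 ⌋ R (coeffHat≡coeffW ((a , b) ∷ cs) m (suc p))))
  (sym (ℕtoℚ-+ (when ⌊ e ≟ a ⌋ (W * G)) (when ⌊ e ≟ 0 ⌋ R)))
  where
  W = ⟦ var ^ᴾ b ⟧ p
  G = coeffW (weighted (powerColumns cs)) m (suc p)
  R = coeffW (weighted (powerColumns ((a , b) ∷ cs))) m (suc p)

M≡coeffW : ∀ α m → M α m ≡ ℕtoℚ (coeffW (unweighted α) m 1)
M≡coeffW α m = trans (coeffHat≡coeffW (map (λ a → a , 0) α) m 1)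
  (cong (λ cs → ℕtoℚ (coeffW cs m 1)) (trans (cong weighted (sym (map-∘ α))) (sym (map-∘ α))))

toLincomb : (L : Combination) → All (LastPosℕ ∘ proj₂) L → List (ℚ × LeftWeakComp)
toLincomb []            []       = []
toLincomb ((c , α) ∷ L) (h ∷ hs) = (ℕtoℚ (⟦ c ⟧ 1) , (α , h)) ∷ toLincomb L hs

ℕtoℚ-⟦⟧ᶜ : ∀ L hs m → ℕtoℚ (⟦ L ⟧ᶜ m 1) ≡ lincomb (M ∘ proj₁) (toLincomb L hs) m
ℕtoℚ-⟦⟧ᶜ []            []       m = refl
ℕtoℚ-⟦⟧ᶜ ((c , α) ∷ L) (h ∷ hs) m = trans (ℕtoℚ-+ (⟦ c ⟧ 1 * coeffW (unweighted α) m 1) (⟦ L ⟧ᶜ m 1))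
  (cong₂ ℚ._+_ (trans (ℕtoℚ-* (⟦ c ⟧ 1) (coeffW (unweighted α) m 1)) (cong (ℕtoℚ (⟦ c ⟧ 1) ℚ.*_) (sym (M≡coeffW α m))))
               (ℕtoℚ-⟦⟧ᶜ L hs m))

Span : {I : Set} → (I → Series) → Series → Set
Span {I} f F = Σ (List (ℚ × I)) λ L → F ≈ₛ lincomb f L

module _ {I : Set} (f : I → Series) where

  lincomb-++ : ∀ A B m → lincomb f (A ++ B) m ≡ lincomb f A m ℚ.+ lincomb f B m
  lincomb-++ []            B m = sym (ℚₚ.+-identityˡ _)
  lincomb-++ ((q , i) ∷ A) B m =
    trans (cong (q ℚ.* f i m ℚ.+_) (lincomb-++ A B m)) (sym (ℚₚ.+-assoc (q ℚ.* f i m) _ _))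

  scale : ℚ → List (ℚ × I) → List (ℚ × I)
  scale q = map (λ (r , i) → q ℚ.* r , i)

  lincomb-scale : ∀ q A m → lincomb f (scale q A) m ≡ q ℚ.* lincomb f A m
  lincomb-scale q []             m = sym (ℚₚ.*-zeroʳ q)
  lincomb-scale q ((r , i) ∷ A) m = begin
    q ℚ.* r ℚ.* f i m ℚ.+ lincomb f (scale q A) m   ≡⟨ cong₂ ℚ._+_ (ℚₚ.*-assoc q r (f i m)) (lincomb-scale q A m) ⟩
    q ℚ.* (r ℚ.* f i m) ℚ.+ q ℚ.* lincomb f A m     ≡⟨ ℚₚ.*-distribˡ-+ q (r ℚ.* f i m) (lincomb f A m) ⟨
    q ℚ.* (r ℚ.* f i m ℚ.+ lincomb f A m)           ∎
    where open ≡-Reasoning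

span-trans : ∀ {I J} {f : I → Series} {g : J → Series} → (∀ i → Span g (f i)) → ∀ F → Span f F → Span g F
span-trans {f = f} {g} f∈g F (L , F≈L) = concatMap expandTerm L , λ m → trans (F≈L m) (lincomb-concatMap L m)
  where
  expandTerm = λ (q , i) → scale g q (proj₁ (f∈g i))
  lincomb-concatMap : ∀ L m → lincomb f L m ≡ lincomb g (concatMap expandTerm L) m
  lincomb-concatMap []            m = refl
  lincomb-concatMap ((q , i) ∷ L) m = sym (begin
    lincomb g (scale g q (proj₁ (f∈g i)) ++ concatMap expandTerm L) m
      ≡⟨ lincomb-++ g (scale g q (proj₁ (f∈g i))) (concatMap expandTerm L) m ⟩
    lincomb g (scale g q (proj₁ (f∈g i))) m ℚ.+ lincomb g (concatMap expandTerm L) m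
      ≡⟨ cong₂ ℚ._+_ (lincomb-scale g q (proj₁ (f∈g i)) m) (sym (lincomb-concatMap L m)) ⟩
    q ℚ.* lincomb g (proj₁ (f∈g i)) m ℚ.+ lincomb f L m
      ≡⟨ cong (λ x → q ℚ.* x ℚ.+ lincomb f L m) (proj₂ (f∈g i) m) ⟨
    q ℚ.* f i m ℚ.+ lincomb f L m ∎)
    where open ≡-Reasoning

Mhat∈span-M : (i : ValidGSymIndex) → Span {LeftWeakComp} (M ∘ proj₁) (Mhat (proj₁ i))
Mhat∈span-M (cs , h) = toLincomb _ (expand-lastPos cs h) , λ m → begin
  Mhat cs m                                            ≡⟨ coeffHat≡coeffW cs m 1 ⟩
  ℕtoℚ (coeffW (weighted (powerColumns cs)) m 1)       ≡⟨ cong ℕtoℚ (coeffW≡⟦expand⟧ᶜ (powerColumns cs) m 1) ⟩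
  ℕtoℚ (⟦ expand (powerColumns cs) ⟧ᶜ m 1)             ≡⟨ ℕtoℚ-⟦⟧ᶜ _ (expand-lastPos cs h) m ⟩
  lincomb (M ∘ proj₁) (toLincomb _ (expand-lastPos cs h)) m ∎
  where open ≡-Reasoning

LastPos-zeroWeights : ∀ α → LastPosℕ α → LastPos (map (λ a → a , 0) α)
LastPos-zeroWeights []          h = tt
LastPos-zeroWeights (a ∷ [])    h = h
LastPos-zeroWeights (a ∷ b ∷ α) h = LastPos-zeroWeights (b ∷ α) h

M∈span-Mhat : (α : LeftWeakComp) → Span {ValidGSymIndex} (Mhat ∘ proj₁) (M (proj₁ α))
M∈span-Mhat (α , h) = (1ℚ , (map (λ a → a , 0) α , LastPos-zeroWeights α h)) ∷ [] ,
  λ m → sym (trans (ℚₚ.+-identityʳ _) (ℚₚ.*-identityˡ _))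

proposition5p6 : (F : Series) → (InGSym F → InLWQSym F) × (InLWQSym F → InGSym F)
proposition5p6 F = span-trans Mhat∈span-M F , span-trans M∈span-Mhat F
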